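{- For every integer $n \ge 2$, $d(n) = n^2 - f(n)$.
   Context: Work in the square grid: cells are unit squares with integer corners, and two cells are neighbors if they share an edge. The $n\times n$ board is an $n \times n$ square of cells. A domino is a set of two adjacent cells. A domino covering of a board is a finite collection (repetitions allowed) of dominoes contained in the board whose union is the board; it is saturated if removing any single domino leaves some cell uncovered. $d(n)$ is the largest number of dominoes in a saturated domino covering of the $n\times n$ board. A fragment is a cell $c$ together with a nonempty subset of its four neighbors. $f(n)$ is the minimum number of fragments in a partition of the $n \times n$ board into fragments each contained in the board. -}

module Defs where

open import Data.Nat using (ℕ; suc; _≤_)
open import Data.Fin using (Fin; toℕ)
open import Data.Product using (Σ; _×_; _,_)
open import Data.Sum using (_⊎_)
open import Data.List using (List; []; length; removeAt; lookup)
open import Data.List.Relation.Unary.Any using (Any)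
open import Data.List.Relation.Unary.All using (All)
open import Data.List.Membership.Propositional using (_∈_)
open import Relation.Binary.PropositionalEquality using (_≡_; _≢_)
open import Relation.Nullary using (¬_)

Cell : ℕ → Set
Cell n = Fin n × Fin n

Differ1 : ℕ → ℕ → Set
Differ1 a b = suc a ≡ b ⊎ suc b ≡ a

Adj : ∀ {n} → Cell n → Cell n → Set
Adj (r₁ , c₁) (r₂ , c₂) =
  (r₁ ≡ r₂ × Differ1 (toℕ c₁) (toℕ c₂)) ⊎ (c₁ ≡ c₂ × Differ1 (toℕ r₁) (toℕ r₂))

record Domino (n : ℕ) : Set where
  constructor domino
  field
    fst  : Cell n
    snd  : Cell n
    adj  : Adj fst snd

_∈D_ : ∀ {n} → Cell n → Domino n → Set
x ∈D d = x ≡ Domino.fst d ⊎ x ≡ Domino.snd d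

Covers : ∀ {n} → List (Domino n) → Set
Covers {n} ds = (x : Cell n) → Any (x ∈D_) ds

Saturated : ∀ {n} → List (Domino n) → Set
Saturated ds = Covers ds × ((i : Fin (length ds)) → ¬ Covers (removeAt ds i))

-- k = d(n): the largest number of dominoes in a saturated covering.
IsMaxSaturated : ℕ → ℕ → Set
IsMaxSaturated n k =
  Σ (List (Domino n)) (λ ds → Saturated ds × length ds ≡ k)
  × ((ds : List (Domino n)) → Saturated ds → length ds ≤ k)

record Fragment (n : ℕ) : Set where
  constructor fragment
  field
    center   : Cell n
    nbrs     : List (Cell n)
    nbrsAdj  : All (Adj center) nbrs
    nonempty : nbrs ≢ []

_∈F_ : ∀ {n} → Cell n → Fragment n → Set
x ∈F f = x ≡ Fragment.center f ⊎ x ∈ Fragment.nbrs f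

IsPartition : ∀ {n} → List (Fragment n) → Set
IsPartition {n} fs =
  (x : Cell n) → Σ (Fin (length fs)) (λ i →
    x ∈F lookup fs i × ((j : Fin (length fs)) → x ∈F lookup fs j → j ≡ i))

-- m = f(n): the minimum number of fragments in a partition of the board.
IsMinFragments : ℕ → ℕ → Set
IsMinFragments n m =
  Σ (List (Fragment n)) (λ fs → IsPartition fs × length fs ≡ m)
  × ((fs : List (Fragment n)) → IsPartition fs → m ≤ length fs)

module Submission where

-- Call t : Cell n → Cell n a star map when every cell is either a centre (fixed by t, with at least
-- one other cell sent to it) or a leaf (adjacent to t x, which is fixed); its cost is the number of
-- centres. The stars {c} ∪ t⁻¹(c) of a star map partition the board into cost-many fragments, and
-- its spokes (x, t x) for leaves x form a saturated covering by n² − cost dominoes, each spoke being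
-- the only one covering its leaf. Conversely, sending every cell to the centre of its fragment turns
-- a partition into a star map of no larger cost, and since each domino of a saturated covering has a
-- private cell, sending that cell to the other cell of its domino turns the covering into a star map
-- with at least as many leaves as dominoes. So a star map of minimum cost m, which exists because
-- star maps exist for n ≥ 2 (pair up adjacent rows) and are finite in number, witnesses both
-- f(n) = m and d(n) = n² − m.

open import Defs
open import Data.Nat using (ℕ; zero; suc; _≤_; _+_; _*_; _∸_; s≤s; z≤n)
open import Data.Nat.Properties using (1+n≢n; +-suc; ≤-trans; ≤-reflexive; m+n∸m≡n; ∸-monoʳ-≤)
open import Data.Fin using (Fin; zero; suc; toℕ)
open import Data.Fin.Properties using (suc-injective; any?; all?; injective⇒≤)
import Data.Fin as Fin
import Data.Nat as ℕ
open import Data.Product using (Σ; Σ-syntax; ∃; ∃-syntax; _×_; _,_; proj₁; proj₂)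
open import Data.Product.Properties using (≡-dec)
open import Data.Sum using (_⊎_; inj₁; inj₂)
import Data.Sum as Sum
open import Data.Empty using (⊥-elim)
open import Data.List
  using ( List; []; _∷_; [_]; _++_; length; lookup; removeAt; filter; map; allFin
        ; cartesianProduct; cartesianProductWith)
open import Data.List.Properties using (length-++; length-map; length-tabulate; map-id; filter-≐)
open import Data.List.Relation.Unary.Any using (Any; here; there; index)
import Data.List.Relation.Unary.Any as Any
open import Data.List.Relation.Unary.Any.Properties using (lookup-index; mapWith∈⁺; mapWith∈⁻; ¬Any[])
import Data.List.Relation.Unary.All as All
open import Data.List.Relation.Unary.All.Properties using (all-filter)
open import Data.List.Relation.Unary.AllPairs using (_∷_)
open import Data.List.Relation.Unary.Unique.Propositional using (Unique)
open import Data.List.Relation.Unary.Unique.Propositional.Properties using (allFin⁺; cartesianProduct⁺; filter⁺)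
open import Data.List.Membership.Propositional using (_∈_; mapWith∈; lose)
open import Data.List.Membership.Propositional.Properties
  using ( ∈-lookup; ∈-map⁺; ∈-allFin; ∈-cartesianProduct⁺; ∈-cartesianProductWith⁺
        ; ∈-filter⁺; ∈-filter⁻; map-mapWith∈; mapWith∈-id)
open import Data.List.Extrema.Nat using (argmin; argmin-all; f[argmin]≤f[xs])
open import Data.Vec using (Vec; []; _∷_)
import Data.Vec as Vec
open import Data.Vec.Properties using (lookup∘tabulate)
open import Function using (_∘_; Injective)
open import Relation.Binary.PropositionalEquality
  using (_≡_; _≢_; refl; sym; trans; cong; cong₂; subst; module ≡-Reasoning)
open import Relation.Nullary using (¬_; Dec; yes; no; ¬?)
open import Relation.Nullary.Decidable using (_×-dec_; _⊎-dec_; decidable-stable)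
import Relation.Nullary.Decidable as Dec
open import Relation.Unary using (Decidable)
open import Relation.Unary.Properties using (∁?)

private
  variable
    A B : Set

length-cartesianProduct : (xs : List A) (ys : List B) →
  length (cartesianProduct xs ys) ≡ length xs * length ys
length-cartesianProduct []       ys = refl
length-cartesianProduct (x ∷ xs) ys = begin
  length (map (x ,_) ys ++ cartesianProduct xs ys)
    ≡⟨ length-++ (map (x ,_) ys) ⟩
  length (map (x ,_) ys) + length (cartesianProduct xs ys)
    ≡⟨ cong₂ _+_ (length-map (x ,_) ys) (length-cartesianProduct xs ys) ⟩
  length ys + length xs * length ys
    ∎
  where open ≡-Reasoning

length-filter+length-filter-∁ : {P : A → Set} (P? : Decidable P) (xs : List A) →
  length (filter P? xs) + length (filter (∁? P?) xs) ≡ length xs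
length-filter+length-filter-∁ P? []       = refl
length-filter+length-filter-∁ P? (x ∷ xs) with P? x
... | yes _ = cong suc (length-filter+length-filter-∁ P? xs)
... | no  _ = trans (+-suc _ _) (cong suc (length-filter+length-filter-∁ P? xs))

lookup-injective : {f : A → B} (xs : List A) → Unique (map f xs) →
  ∀ i j → f (lookup xs i) ≡ f (lookup xs j) → i ≡ j
lookup-injective         (x ∷ xs) (_   ∷ _) zero    zero    _ = refl
lookup-injective {f = f} (x ∷ xs) (fx∉ ∷ _) zero    (suc j) e =
  ⊥-elim (All.lookup fx∉ (∈-map⁺ f (∈-lookup j)) e)
lookup-injective {f = f} (x ∷ xs) (fx∉ ∷ _) (suc i) zero    e =
  ⊥-elim (All.lookup fx∉ (∈-map⁺ f (∈-lookup i)) (sym e))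
lookup-injective         (x ∷ xs) (_   ∷ u) (suc i) (suc j) e = cong suc (lookup-injective xs u i j e)

injective⇒≤length : ∀ {k} {f : Fin k → A} {ys : List A} →
  Injective _≡_ _≡_ f → (∀ i → f i ∈ ys) → k ≤ length ys
injective⇒≤length {f = f} {ys} f-inj f∈ys = injective⇒≤ position-injective
  where
  position-injective : Injective _≡_ _≡_ (λ i → index (f∈ys i))
  position-injective {i} {j} e =
    f-inj (trans (lookup-index (f∈ys i)) (trans (cong (lookup ys) e) (sym (lookup-index (f∈ys j)))))

Any-removeAt⁻ : {P : A → Set} (xs : List A) (i : Fin (length xs)) →
  Any P (removeAt xs i) → ∃[ j ] (j ≢ i × P (lookup xs j))
Any-removeAt⁻ (x ∷ xs) zero    p         = suc (index p) , (λ ()) , lookup-index p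
Any-removeAt⁻ (x ∷ xs) (suc i) (here px) = zero , (λ ()) , px
Any-removeAt⁻ (x ∷ xs) (suc i) (there p) with j , j≢i , pj ← Any-removeAt⁻ xs i p =
  suc j , j≢i ∘ suc-injective , pj

Any-removeAt⁺ : {P : A → Set} (xs : List A) (i j : Fin (length xs)) →
  j ≢ i → P (lookup xs j) → Any P (removeAt xs i)
Any-removeAt⁺ (x ∷ xs) zero    zero    j≢i _  = ⊥-elim (j≢i refl)
Any-removeAt⁺ (x ∷ xs) zero    (suc j) _   pj = lose (∈-lookup j) pj
Any-removeAt⁺ (x ∷ xs) (suc i) zero    _   px = here px
Any-removeAt⁺ (x ∷ xs) (suc i) (suc j) j≢i pj = there (Any-removeAt⁺ xs i j (j≢i ∘ cong suc) pj)

allVec : List A → (k : ℕ) → List (Vec A k)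
allVec xs zero    = [ [] ]
allVec xs (suc k) = cartesianProductWith _∷_ xs (allVec xs k)

∈-allVec : {xs : List A} → (∀ x → x ∈ xs) → ∀ {k} (v : Vec A k) → v ∈ allVec xs k
∈-allVec complete []      = here refl
∈-allVec complete (x ∷ v) = ∈-cartesianProductWith⁺ _∷_ (complete x) (∈-allVec complete v)

IsCentre : (A → A) → A → Set
IsCentre t x = t x ≡ x × ∃[ y ] (y ≢ x × t y ≡ x)

IsLeaf : (A → A → Set) → (A → A) → A → Set
IsLeaf _~_ t x = x ~ t x × t (t x) ≡ t x

IsStarMap : (A → A → Set) → (A → A) → Set
IsStarMap _~_ t = ∀ x → IsCentre t x ⊎ IsLeaf _~_ t x

IsStarMap-resp : {_~_ : A → A → Set} {s t : A → A} →
  (∀ x → s x ≡ t x) → IsStarMap _~_ s → IsStarMap _~_ t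
IsStarMap-resp {_~_ = _~_} {s} {t} s≗t star x with star x
... | inj₁ (sx≡x , y , y≢x , sy≡x) =
  inj₁ (trans (sym (s≗t x)) sx≡x , y , y≢x , trans (sym (s≗t y)) sy≡x)
... | inj₂ (x~sx , ssx≡sx) =
  inj₂ (subst (x ~_) (s≗t x) x~sx , tt≡t)
  where
  open ≡-Reasoning
  tt≡t : t (t x) ≡ t x
  tt≡t = begin
    t (t x)  ≡⟨ cong t (s≗t x) ⟨
    t (s x)  ≡⟨ s≗t (s x) ⟨
    s (s x)  ≡⟨ ssx≡sx ⟩
    s x      ≡⟨ s≗t x ⟩
    t x      ∎

Differ1-sym : ∀ {a b} → Differ1 a b → Differ1 b a
Differ1-sym = Sum.swap

Differ1-irrefl : ∀ {a} → ¬ Differ1 a a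
Differ1-irrefl (inj₁ e) = 1+n≢n e
Differ1-irrefl (inj₂ e) = 1+n≢n e

PathAdj : ∀ {k} → Fin k → Fin k → Set
PathAdj r s = Differ1 (toℕ r) (toℕ s)

-- Pairs the rows {0,1}, {2,3}, …; with an odd number of rows the last row joins the star of row n − 2.
hub : ∀ k → Fin (2 + k) → Fin (2 + k)
hub k             zero             = suc zero
hub k             (suc zero)       = suc zero
hub 1             (suc (suc zero)) = suc zero
hub (suc (suc k)) (suc (suc r))    = suc (suc (hub k r))

hub-starMap : ∀ k → IsStarMap PathAdj (hub k)
hub-starMap k             zero             = inj₂ (inj₁ refl , refl)
hub-starMap k             (suc zero)       = inj₁ (refl , zero , (λ ()) , refl)
hub-starMap 1             (suc (suc zero)) = inj₂ (inj₂ refl , refl)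
hub-starMap (suc (suc k)) (suc (suc r))    with hub-starMap k r
... | inj₁ (h≡r , y , y≢r , hy≡r) =
  inj₁ ( cong (Fin.suc ∘ Fin.suc) h≡r
       , suc (suc y) , y≢r ∘ suc-injective ∘ suc-injective , cong (Fin.suc ∘ Fin.suc) hy≡r)
... | inj₂ (r~h , hh≡h) =
  inj₂ (Sum.map (cong (ℕ.suc ∘ ℕ.suc)) (cong (ℕ.suc ∘ ℕ.suc)) r~h , cong (Fin.suc ∘ Fin.suc) hh≡h)

columnMap : ∀ {n} → (Fin n → Fin n) → Cell n → Cell n
columnMap h (r , c) = h r , c

columnMap-starMap : ∀ {n} {h : Fin n → Fin n} → IsStarMap PathAdj h → IsStarMap Adj (columnMap h)
columnMap-starMap star (r , c) with star r
... | inj₁ (hr≡r , y , y≢r , hy≡r) =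
  inj₁ (cong (_, c) hr≡r , (y , c) , (λ e → y≢r (cong proj₁ e)) , cong (_, c) hy≡r)
... | inj₂ (r~hr , hhr≡hr) = inj₂ (inj₂ (refl , r~hr) , cong (_, c) hhr≡hr)

partition-by-centre : ∀ {n} (ρ : Cell n → Cell n) (fs : List (Fragment n)) →
  Unique (map Fragment.center fs) →
  (∀ {f} → f ∈ fs → ∀ {x} → x ∈F f → ρ x ≡ Fragment.center f) →
  (∀ x → Any (x ∈F_) fs) → IsPartition fs
partition-by-centre ρ fs centres-unique owns cover x = index (cover x) , lookup-index (cover x) , only
  where
  only : ∀ j → x ∈F lookup fs j → j ≡ index (cover x)
  only j x∈j = lookup-injective fs centres-unique j (index (cover x))
    (trans (sym (owns (∈-lookup j) x∈j)) (owns (∈-lookup (index (cover x))) (lookup-index (cover x))))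

IsPrivate : ∀ {n} (ds : List (Domino n)) → Fin (length ds) → Cell n → Set
IsPrivate ds i x = x ∈D lookup ds i × (∀ j → x ∈D lookup ds j → j ≡ i)

privateCells⇒saturated : ∀ {n} {ds : List (Domino n)} →
  Covers ds → (∀ i → ∃ (IsPrivate ds i)) → Saturated ds
privateCells⇒saturated {ds = ds} cover has-private = cover , uncovers
  where
  uncovers : ∀ i → ¬ Covers (removeAt ds i)
  uncovers i covers with x , _ , only-i ← has-private i
                    with j , j≢i , x∈j ← Any-removeAt⁻ ds i (covers x) = j≢i (only-i j x∈j)

module Board (n : ℕ) where

  _≟_ : (x y : Cell n) → Dec (x ≡ y)
  _≟_ = ≡-dec Fin._≟_ Fin._≟_

  Differ1? : (a b : ℕ) → Dec (Differ1 a b)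
  Differ1? a b = (suc a ℕ.≟ b) ⊎-dec (suc b ℕ.≟ a)

  Adj? : (x y : Cell n) → Dec (Adj x y)
  Adj? (r₁ , c₁) (r₂ , c₂) =
    ((r₁ Fin.≟ r₂) ×-dec Differ1? (toℕ c₁) (toℕ c₂))
      ⊎-dec ((c₁ Fin.≟ c₂) ×-dec Differ1? (toℕ r₁) (toℕ r₂))

  Adj-sym : ∀ {x y : Cell n} → Adj x y → Adj y x
  Adj-sym = Sum.map (λ (e , d) → sym e , Differ1-sym d) (λ (e , d) → sym e , Differ1-sym d)

  Adj-irrefl : ∀ {x : Cell n} → ¬ Adj x x
  Adj-irrefl (inj₁ (_ , d)) = Differ1-irrefl d
  Adj-irrefl (inj₂ (_ , d)) = Differ1-irrefl d

  ∃-cell? : {P : Cell n → Set} → Decidable P → Dec (∃ P)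
  ∃-cell? P? = Dec.map′ (λ (r , c , p) → (r , c) , p) (λ ((r , c) , p) → r , c , p)
                        (any? λ r → any? λ c → P? (r , c))

  ∀-cell? : {P : Cell n → Set} → Decidable P → Dec (∀ x → P x)
  ∀-cell? P? = Dec.map′ (λ all (r , c) → all r c) (λ all r c → all (r , c))
                        (all? λ r → all? λ c → P? (r , c))

  cells : List (Cell n)
  cells = cartesianProduct (allFin n) (allFin n)

  ∈-cells : ∀ x → x ∈ cells
  ∈-cells (r , c) = ∈-cartesianProduct⁺ (∈-allFin r) (∈-allFin c)

  cells-unique : Unique cells
  cells-unique = cartesianProduct⁺ (allFin⁺ n) (allFin⁺ n)

  length-cells : length cells ≡ n * n
  length-cells = trans (length-cartesianProduct (allFin n) (allFin n)) (cong₂ _*_ length-allFin length-allFin)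
    where
    length-allFin : length (allFin n) ≡ n
    length-allFin = length-tabulate {n = n} (λ i → i)

  module _ (t : Cell n → Cell n) where

    fixed? : Decidable (λ x → t x ≡ x)
    fixed? x = t x ≟ x

    centres : List (Cell n)
    centres = filter fixed? cells

    leaves : List (Cell n)
    leaves = filter (∁? fixed?) cells

    cost : ℕ
    cost = length centres

    ∈-centres⇒fixed : ∀ {c} → c ∈ centres → t c ≡ c
    ∈-centres⇒fixed c∈ = proj₂ (∈-filter⁻ fixed? {xs = cells} c∈)

    ∈-leaves⇒unfixed : ∀ {x} → x ∈ leaves → t x ≢ x
    ∈-leaves⇒unfixed x∈ = proj₂ (∈-filter⁻ (∁? fixed?) {xs = cells} x∈)

    length-leaves : length leaves ≡ n * n ∸ cost
    length-leaves = begin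
      length leaves                         ≡⟨ m+n∸m≡n cost _ ⟨
      cost + length leaves ∸ cost           ≡⟨ cong (_∸ cost) (length-filter+length-filter-∁ fixed? cells) ⟩
      length cells ∸ cost                   ≡⟨ cong (_∸ cost) length-cells ⟩
      n * n ∸ cost                          ∎
      where open ≡-Reasoning

  cost-resp : ∀ {s t} → (∀ x → s x ≡ t x) → cost s ≡ cost t
  cost-resp {s} {t} s≗t =
    cong length (filter-≐ (fixed? s) (fixed? t) ((λ {x} → trans (sym (s≗t x))) , (λ {x} → trans (s≗t x)))
                          cells)

  module StarForest {t : Cell n → Cell n} (star : IsStarMap Adj t) where

    fixed⇒centre : ∀ {x} → t x ≡ x → IsCentre t x
    fixed⇒centre {x} tx≡x with star x
    ... | inj₁ centre       = centre
    ... | inj₂ (x~tx , _)   = ⊥-elim (Adj-irrefl (subst (Adj x) tx≡x x~tx))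

    unfixed⇒leaf : ∀ {x} → t x ≢ x → IsLeaf Adj t x
    unfixed⇒leaf {x} tx≢x with star x
    ... | inj₁ (tx≡x , _) = ⊥-elim (tx≢x tx≡x)
    ... | inj₂ leaf       = leaf

    t-idem : ∀ x → t (t x) ≡ t x
    t-idem x with star x
    ... | inj₁ (tx≡x , _)   = cong t tx≡x
    ... | inj₂ (_ , ttx≡tx) = ttx≡tx

    leafOf? : (c : Cell n) → Decidable (λ y → y ≢ c × t y ≡ c)
    leafOf? c y = ¬? (y ≟ c) ×-dec (t y ≟ c)

    starAt : (c : Cell n) → t c ≡ c → Fragment n
    starAt c tc≡c = fragment c (filter (leafOf? c) cells) (All.tabulate leaf-adj) nonempty
      where
      leaf-adj : ∀ {y} → y ∈ filter (leafOf? c) cells → Adj c y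
      leaf-adj y∈ with y≢c , ty≡c ← proj₂ (∈-filter⁻ (leafOf? c) {xs = cells} y∈) =
        Adj-sym (subst (Adj _) ty≡c (proj₁ (unfixed⇒leaf (λ ty≡y → y≢c (trans (sym ty≡y) ty≡c)))))
      nonempty : filter (leafOf? c) cells ≢ []
      nonempty eq with y , leaf ← proj₂ (fixed⇒centre tc≡c) =
        ¬Any[] (subst (y ∈_) eq (∈-filter⁺ (leafOf? c) (∈-cells y) leaf))

    ∈-starAt⁻ : ∀ {c x} (tc≡c : t c ≡ c) → x ∈F starAt c tc≡c → t x ≡ c
    ∈-starAt⁻     tc≡c (inj₁ refl) = tc≡c
    ∈-starAt⁻ {c} _    (inj₂ x∈)   = proj₂ (proj₂ (∈-filter⁻ (leafOf? c) {xs = cells} x∈))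

    -- The proof that the centre is fixed only enters the nonemptiness field, so it is arbitrary here.
    ∈-starAt⁺ : ∀ x {ttx≡tx} → x ∈F starAt (t x) ttx≡tx
    ∈-starAt⁺ x with x ≟ t x
    ... | yes x≡tx = inj₁ x≡tx
    ... | no  x≢tx = inj₂ (∈-filter⁺ (leafOf? (t x)) (∈-cells x) (x≢tx , refl))

    starOf : ∀ {c} → c ∈ centres t → Fragment n
    starOf c∈ = starAt _ (∈-centres⇒fixed t c∈)

    stars : List (Fragment n)
    stars = mapWith∈ (centres t) starOf

    map-center-stars : map Fragment.center stars ≡ centres t
    map-center-stars = trans (map-mapWith∈ (centres t) _ Fragment.center) (mapWith∈-id (centres t))

    stars-partition : IsPartition stars
    stars-partition = partition-by-centre t stars
      (subst Unique (sym map-center-stars) (filter⁺ (fixed? t) cells-unique)) owns cover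
      where
      owns : ∀ {f} → f ∈ stars → ∀ {x} → x ∈F f → t x ≡ Fragment.center f
      owns f∈ x∈f with _ , c∈ , refl ← mapWith∈⁻ (centres t) starOf f∈ =
        ∈-starAt⁻ (∈-centres⇒fixed t c∈) x∈f
      cover : ∀ x → Any (x ∈F_) stars
      cover x = mapWith∈⁺ starOf (t x , tx∈ , ∈-starAt⁺ x {∈-centres⇒fixed t tx∈})
        where tx∈ = ∈-filter⁺ (fixed? t) (∈-cells (t x)) (t-idem x)

    length-stars : length stars ≡ cost t
    length-stars = trans (sym (length-map Fragment.center stars)) (cong length map-center-stars)

    spokeOf : ∀ {x} → x ∈ leaves t → Domino n
    spokeOf {x} x∈ = domino x (t x) (proj₁ (unfixed⇒leaf (∈-leaves⇒unfixed t x∈)))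

    spokes : List (Domino n)
    spokes = mapWith∈ (leaves t) spokeOf

    map-fst-spokes : map Domino.fst spokes ≡ leaves t
    map-fst-spokes = trans (map-mapWith∈ (leaves t) _ Domino.fst) (mapWith∈-id (leaves t))

    spoke-shape : ∀ {d} → d ∈ spokes → t (Domino.fst d) ≢ Domino.fst d × Domino.snd d ≡ t (Domino.fst d)
    spoke-shape d∈ with _ , x∈ , refl ← mapWith∈⁻ (leaves t) spokeOf d∈ =
      ∈-leaves⇒unfixed t x∈ , refl

    spokes-saturated : Saturated spokes
    spokes-saturated = privateCells⇒saturated cover (λ i → _ , inj₁ refl , only i)
      where
      cover : Covers spokes
      cover x with t x ≟ x
      ... | no tx≢x = mapWith∈⁺ spokeOf (x , ∈-filter⁺ (∁? (fixed? t)) (∈-cells x) tx≢x , inj₁ refl)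
      ... | yes tx≡x with y , y≢x , ty≡x ← proj₂ (fixed⇒centre tx≡x) =
        mapWith∈⁺ spokeOf (y , ∈-filter⁺ (∁? (fixed? t)) (∈-cells y) (λ ty≡y → y≢x (trans (sym ty≡y) ty≡x)) ,
                     inj₂ (sym ty≡x))
      -- A spoke's leaf is covered by no other spoke: leaves are distinct, and the other end of a spoke is fixed.
      only : ∀ i j → Domino.fst (lookup spokes i) ∈D lookup spokes j → j ≡ i
      only i j (inj₁ x≡fst) =
        lookup-injective spokes (subst Unique (sym map-fst-spokes) (filter⁺ _ cells-unique)) j i (sym x≡fst)
      only i j (inj₂ x≡snd) with x-unfixed , _ ← spoke-shape (∈-lookup i)
                            with _ , snd≡t ← spoke-shape (∈-lookup j) =
        ⊥-elim (x-unfixed (trans (cong t x≡ty) (trans (t-idem _) (sym x≡ty))))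
        where x≡ty = trans x≡snd snd≡t

    length-spokes : length spokes ≡ n * n ∸ cost t
    length-spokes = begin
      length spokes                    ≡⟨ sym (length-map Domino.fst spokes) ⟩
      length (map Domino.fst spokes)   ≡⟨ cong length map-fst-spokes ⟩
      length (leaves t)                ≡⟨ length-leaves t ⟩
      n * n ∸ cost t                   ∎
      where open ≡-Reasoning

  starMap⇒partition : ∀ {t} → IsStarMap Adj t →
    Σ[ fs ∈ List (Fragment n) ] IsPartition fs × length fs ≡ cost t
  starMap⇒partition star = stars , stars-partition , length-stars
    where open StarForest star

  starMap⇒saturated : ∀ {t} → IsStarMap Adj t →
    Σ[ ds ∈ List (Domino n) ] Saturated ds × length ds ≡ n * n ∸ cost t
  starMap⇒saturated star = spokes , spokes-saturated , length-spokes
    where open StarForest star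

  some-neighbour : (f : Fragment n) → ∃[ y ] (y ∈ Fragment.nbrs f)
  some-neighbour (fragment _ []      _ nonempty) = ⊥-elim (nonempty refl)
  some-neighbour (fragment _ (y ∷ _) _ _)        = y , here refl

  module CentreOf {fs : List (Fragment n)} (partition : IsPartition fs) where

    owner : Cell n → Fin (length fs)
    owner x = proj₁ (partition x)

    centreOf : Cell n → Cell n
    centreOf x = Fragment.center (lookup fs (owner x))

    centreOf-∈ : ∀ {x j} → x ∈F lookup fs j → centreOf x ≡ Fragment.center (lookup fs j)
    centreOf-∈ {x} x∈j = cong (Fragment.center ∘ lookup fs) (sym (proj₂ (proj₂ (partition x)) _ x∈j))

    neighbour-adj : ∀ {x y} → y ∈ Fragment.nbrs (lookup fs (owner x)) → Adj (centreOf x) y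
    neighbour-adj {x} = All.lookup (Fragment.nbrsAdj (lookup fs (owner x)))

    centreOf-starMap : IsStarMap Adj centreOf
    centreOf-starMap x with x ≟ centreOf x | proj₁ (proj₂ (partition x))
    ... | no x≢c | inj₁ x≡c = ⊥-elim (x≢c x≡c)
    ... | no _   | inj₂ x∈  = inj₂ (Adj-sym (neighbour-adj x∈) , centreOf-∈ (inj₁ refl))
    ... | yes x≡c | _ with y , y∈ ← some-neighbour (lookup fs (owner x)) =
      inj₁ (sym x≡c , y , y≢x , trans (centreOf-∈ (inj₂ y∈)) (sym x≡c))
      where
      y≢x : y ≢ x
      y≢x refl = Adj-irrefl (subst (λ z → Adj z y) (sym x≡c) (neighbour-adj y∈))

    -- Distinct centres lie in distinct fragments.
    cost-centreOf : cost centreOf ≤ length fs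
    cost-centreOf = injective⇒≤ owner-injective
      where
      cs = centres centreOf
      fixed : ∀ i → centreOf (lookup cs i) ≡ lookup cs i
      fixed i = ∈-centres⇒fixed centreOf (∈-lookup i)
      owner-injective : Injective _≡_ _≡_ (λ i → owner (lookup cs i))
      owner-injective {i} {j} e =
        lookup-injective {f = λ x → x} cs cs-unique i j
          (trans (sym (fixed i)) (trans (cong (Fragment.center ∘ lookup fs) e) (fixed j)))
        where cs-unique = subst Unique (sym (map-id cs)) (filter⁺ (fixed? centreOf) cells-unique)

  partition⇒starMap : ∀ {fs} → IsPartition fs →
    Σ[ t ∈ (Cell n → Cell n) ] IsStarMap Adj t × cost t ≤ length fs
  partition⇒starMap {fs} partition = centreOf , centreOf-starMap , cost-centreOf
    where open CentreOf {fs} partition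

  _∈D?_ : (x : Cell n) (d : Domino n) → Dec (x ∈D d)
  x ∈D? d = (x ≟ Domino.fst d) ⊎-dec (x ≟ Domino.snd d)

  saturated⇒privateCells : ∀ {ds} → Saturated ds → ∀ i → ∃ (IsPrivate ds i)
  saturated⇒privateCells {ds} (cover , minimal) i
    with ∃-cell? (λ x → ¬? (Any.any? (x ∈D?_) (removeAt ds i)))
  ... | no none = ⊥-elim (minimal i λ x →
          decidable-stable (Any.any? (x ∈D?_) (removeAt ds i)) (λ x∉ → none (x , x∉)))
  ... | yes (x , x∉) = x , subst (λ k → x ∈D lookup ds k) (only-i _ x∈) x∈ , only-i
    where
    x∈ = lookup-index (cover x)
    only-i : ∀ j → x ∈D lookup ds j → j ≡ i
    only-i j x∈j with j Fin.≟ i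
    ... | yes j≡i = j≡i
    ... | no  j≢i = ⊥-elim (x∉ (Any-removeAt⁺ ds i j j≢i x∈j))

  other : ∀ {x} (d : Domino n) → x ∈D d → Cell n
  other d (inj₁ _) = Domino.snd d
  other d (inj₂ _) = Domino.fst d

  Adj-other : ∀ {x} (d : Domino n) (x∈ : x ∈D d) → Adj x (other d x∈)
  Adj-other (domino _ _ adj) (inj₁ refl) = adj
  Adj-other (domino _ _ adj) (inj₂ refl) = Adj-sym adj

  other-∈D : ∀ {x} (d : Domino n) (x∈ : x ∈D d) → other d x∈ ∈D d
  other-∈D d (inj₁ _) = inj₂ refl
  other-∈D d (inj₂ _) = inj₁ refl

  ∈D⇒≡∨other : ∀ {x y} (d : Domino n) (x∈ : x ∈D d) → y ∈D d → y ≡ x ⊎ y ≡ other d x∈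
  ∈D⇒≡∨other d (inj₁ x≡) (inj₁ y≡) = inj₁ (trans y≡ (sym x≡))
  ∈D⇒≡∨other d (inj₁ _)  (inj₂ y≡) = inj₂ y≡
  ∈D⇒≡∨other d (inj₂ _)  (inj₁ y≡) = inj₂ y≡
  ∈D⇒≡∨other d (inj₂ x≡) (inj₂ y≡) = inj₁ (trans y≡ (sym x≡))

  -- Each domino is turned into the edge from its private cell p to its other cell q; all other cells are fixed.
  module Redirect {ds : List (Domino n)} (saturated : Saturated ds) where

    p : Fin (length ds) → Cell n
    p i = proj₁ (saturated⇒privateCells saturated i)

    p∈ : ∀ i → p i ∈D lookup ds i
    p∈ i = proj₁ (proj₂ (saturated⇒privateCells saturated i))

    only : ∀ i j → p i ∈D lookup ds j → j ≡ i
    only i = proj₂ (proj₂ (saturated⇒privateCells saturated i))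

    q : Fin (length ds) → Cell n
    q i = other (lookup ds i) (p∈ i)

    p≢q : ∀ i → p i ≢ q i
    p≢q i p≡q = Adj-irrefl (subst (Adj (p i)) (sym p≡q) (Adj-other _ (p∈ i)))

    p-injective : Injective _≡_ _≡_ p
    p-injective {i} {j} pi≡pj = sym (only i j (subst (_∈D lookup ds j) (sym pi≡pj) (p∈ j)))

    q≢p : ∀ i j → q i ≢ p j
    q≢p i j qi≡pj with refl ← only j i (subst (_∈D lookup ds i) qi≡pj (other-∈D _ (p∈ i))) =
      p≢q i (sym qi≡pj)

    redirect : Cell n → Cell n
    redirect x with any? (λ i → p i ≟ x)
    ... | yes (i , _) = q i
    ... | no  _       = x

    redirect-p : ∀ i → redirect (p i) ≡ q i
    redirect-p i with any? (λ j → p j ≟ p i)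
    ... | yes (j , pj≡pi) = cong q (p-injective pj≡pi)
    ... | no  none        = ⊥-elim (none (i , refl))

    redirect-unused : ∀ {x} → (∀ i → p i ≢ x) → redirect x ≡ x
    redirect-unused {x} unused with any? (λ i → p i ≟ x)
    ... | yes (i , pi≡x) = ⊥-elim (unused i pi≡x)
    ... | no  _          = refl

    redirect-starMap : IsStarMap Adj redirect
    redirect-starMap x with any? (λ i → p i ≟ x)
    ... | yes (i , refl) =
      inj₂ (Adj-other _ (p∈ i) , redirect-unused (λ j → q≢p i j ∘ sym))
    ... | no none with ∈D⇒≡∨other _ (p∈ _) (lookup-index (proj₁ saturated x))
    ...   | inj₁ x≡pj = ⊥-elim (none (_ , sym x≡pj))
    ...   | inj₂ x≡qj =
      inj₁ (refl , p _ , (λ pj≡x → none (_ , pj≡x)) , trans (redirect-p _) (sym x≡qj))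

    length≤leaves : length ds ≤ length (leaves redirect)
    length≤leaves = injective⇒≤length p-injective λ i →
      ∈-filter⁺ (∁? (fixed? redirect)) (∈-cells (p i))
                (λ rpi≡pi → p≢q i (trans (sym rpi≡pi) (redirect-p i)))

  saturated⇒starMap : ∀ {ds} → Saturated ds →
    Σ[ t ∈ (Cell n → Cell n) ] IsStarMap Adj t × length ds ≤ n * n ∸ cost t
  saturated⇒starMap {ds} saturated =
    redirect , redirect-starMap , ≤-trans length≤leaves (≤-reflexive (length-leaves redirect))
    where open Redirect {ds} saturated

  Table : Set
  Table = Vec (Vec (Cell n) n) n

  applyTable : Table → Cell n → Cell n
  applyTable T (r , c) = Vec.lookup (Vec.lookup T r) c

  toTable : (Cell n → Cell n) → Table
  toTable t = Vec.tabulate λ r → Vec.tabulate λ c → t (r , c)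

  applyTable-toTable : ∀ t x → applyTable (toTable t) x ≡ t x
  applyTable-toTable t (r , c) =
    trans (cong (λ row → Vec.lookup row c) (lookup∘tabulate _ r)) (lookup∘tabulate _ c)

  tables : List Table
  tables = allVec (allVec cells n) n

  isStarMap? : Decidable (IsStarMap Adj)
  isStarMap? t = ∀-cell? λ x → isCentre? x ⊎-dec isLeaf? x
    where
    isCentre? : Decidable (IsCentre t)
    isCentre? x = (t x ≟ x) ×-dec ∃-cell? (λ y → ¬? (y ≟ x) ×-dec (t y ≟ x))
    isLeaf? : Decidable (IsLeaf Adj t)
    isLeaf? x = Adj? x (t x) ×-dec (t (t x) ≟ t x)

  -- Maps are compared through their tables, of which there are finitely many.
  optimalStarMap : ∀ {t₀} → IsStarMap Adj t₀ →
    Σ[ t ∈ (Cell n → Cell n) ] IsStarMap Adj t × (∀ s → IsStarMap Adj s → cost t ≤ cost s)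
  optimalStarMap {t₀} star₀ =
    applyTable best
    , argmin-all (cost ∘ applyTable) (table-starMap star₀) (all-filter starTable? tables)
    , optimal
    where
    starTable? = isStarMap? ∘ applyTable
    best = argmin (cost ∘ applyTable) (toTable t₀) (filter starTable? tables)
    table-starMap : ∀ {s} → IsStarMap Adj s → IsStarMap Adj (applyTable (toTable s))
    table-starMap {s} = IsStarMap-resp {_~_ = Adj} (λ x → sym (applyTable-toTable s x))
    optimal : ∀ s → IsStarMap Adj s → cost (applyTable best) ≤ cost s
    optimal s star = ≤-trans
      (All.lookup (f[argmin]≤f[xs] {f = cost ∘ applyTable} (toTable t₀) (filter starTable? tables))
                  (∈-filter⁺ starTable? (∈-allVec (∈-allVec ∈-cells) (toTable s)) (table-starMap star)))
      (≤-reflexive (cost-resp (applyTable-toTable s)))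

  optimal⇒minFragments-maxSaturated : ∀ {t} → IsStarMap Adj t →
    (∀ s → IsStarMap Adj s → cost t ≤ cost s) →
    IsMinFragments n (cost t) × IsMaxSaturated n (n * n ∸ cost t)
  optimal⇒minFragments-maxSaturated {t} star optimal =
    (starMap⇒partition star , fewest) , (starMap⇒saturated star , most)
    where
    fewest : ∀ fs → IsPartition fs → cost t ≤ length fs
    fewest fs partition with s , star-s , cost≤ ← partition⇒starMap {fs} partition =
      ≤-trans (optimal s star-s) cost≤
    most : ∀ ds → Saturated ds → length ds ≤ n * n ∸ cost t
    most ds saturated with s , star-s , length≤ ← saturated⇒starMap {ds} saturated =
      ≤-trans length≤ (∸-monoʳ-≤ (n * n) (optimal s star-s))

mainTheorem7 : (n : ℕ) → 2 ≤ n →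
    Σ ℕ (λ m → IsMinFragments n m × IsMaxSaturated n (n * n ∸ m))
mainTheorem7 (suc (suc k)) (s≤s (s≤s z≤n)) =
  let t , star , optimal = optimalStarMap (columnMap-starMap (hub-starMap k))
  in  cost t , optimal⇒minFragments-maxSaturated star optimal
  where open Board (2 + k)
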